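{- Let $\pi=\pi_1\cdots\pi_n$ be a Cayley permutation and suppose $\pi_i<\pi_j$ for some $i<j$. Then the entry $\pi_i$ precedes the entry $\pi_j$ in $s_{21}(\pi)$.
   Context: A Cayley permutation is a finite word $\pi=\pi_1\cdots\pi_n$ over the positive integers such that every integer from $1$ to $\max(\pi)$ occurs at least once. A $21$-stack processes an input word from left to right with the following right-greedy algorithm: while the input is nonempty, if pushing the next input element onto the stack yields stack contents which, read from top to bottom, avoid the pattern $21$ (i.e. are weakly increasing from top to bottom), the element is pushed; otherwise the top element of the stack is popped and appended to the output. When the input is exhausted, the remaining elements are popped one by one. $s_{21}(\pi)$ denotes the output on input $\pi$. -}

module Defs where

open import Data.Nat using (ℕ; zero; suc; _≤_; _<_; _≤ᵇ_; _⊔_)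
open import Data.Bool using (Bool; true; false; _∧_)
open import Data.Fin using (Fin)
open import Data.Vec using (Vec; toList; zip; allFin; foldr; lookup)
open import Data.Vec.Membership.Propositional using (_∈_)
open import Data.List using (List; []; _∷_; _++_; [_])
open import Data.Product using (_×_; _,_; proj₁; proj₂)
open import Data.Vec.Relation.Unary.All using (All)

maxVec : ∀ {n} → Vec ℕ n → ℕ
maxVec = foldr _ _⊔_ 0

IsCayley : ∀ {n} → Vec ℕ n → Set
IsCayley π = All (λ x → 1 ≤ x) π × (∀ k → 1 ≤ k → k ≤ maxVec π → k ∈ π)

-- Entries are labelled by their position in π, so that equal values
-- remain distinguishable; an entry is a pair (position , value).
Entry : ℕ → Set
Entry n = Fin n × ℕ

-- Stack contents read top to bottom avoid 21 (weakly increasing).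
avoids21 : ∀ {n} → List (Entry n) → Bool
avoids21 [] = true
avoids21 (x ∷ []) = true
avoids21 (x ∷ y ∷ ys) = (proj₂ x ≤ᵇ proj₂ y) ∧ avoids21 (y ∷ ys)

pushElt : ∀ {n} → Entry n → List (Entry n) → List (Entry n) →
          List (Entry n) × List (Entry n)
pushElt x st out with avoids21 (x ∷ st)
... | true = (x ∷ st , out)
pushElt x [] out | false = ([ x ] , out)  -- unreachable: singleton avoids 21
pushElt x (y ∷ st) out | false = pushElt x st (out ++ [ y ])

run : ∀ {n} → List (Entry n) → List (Entry n) → List (Entry n) → List (Entry n)
run [] st out = out ++ st
run (x ∷ xs) st out with pushElt x st out
... | (st' , out') = run xs st' out'

s21Entries : ∀ {n} → Vec ℕ n → List (Entry n)
s21Entries {n} π = run (toList (zip (allFin n) π)) [] []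

s21Positions : ∀ {n} → Vec ℕ n → List (Fin n)
s21Positions π = Data.List.map proj₁ (s21Entries π)

-- Let e and f be entries of the input with e before f and value e < value f.
-- While f has not yet arrived, e is either still on the stack or already in
-- the output.  In the first case pushing f forces e off the stack, because the
-- stack must stay weakly increasing from the top and e is smaller than f; in
-- either case e is output before f, which is output only after it is pushed.
-- The argument works for arbitrary words, so the Cayley hypothesis is unused.
module Submission where

open import Defs
open import Data.Nat using (ℕ; _<_)
open import Data.Fin using (Fin) renaming (_<_ to _<ᶠ_)
open import Data.Vec using (Vec; lookup)
open import Data.List using (List; _∷_; _++_)
open import Data.Product using (∃-syntax)
open import Relation.Binary.PropositionalEquality using (_≡_)

open import Data.Bool using (T; true; false)
open import Data.Bool.Properties using (T-≡; T-∧)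
open import Data.Empty using (⊥-elim)
open import Data.Fin using (zero; suc)
open import Data.List using ([]; [_]; map)
open import Data.List.Membership.Propositional using (_∈_)
open import Data.List.Membership.Propositional.Properties using (∈-∃++; ∈-++⁺ˡ; ∈-++⁺ʳ)
open import Data.List.Properties using (++-assoc; ++-identityʳ; map-++)
open import Data.List.Relation.Unary.Any using (here; there)
open import Data.Nat using (_≤_; _≤ᵇ_; s≤s)
open import Data.Nat.Properties using (≤ᵇ⇒≤; ≤-trans; ≤⇒≯)
open import Data.Product using (_×_; _,_; proj₁; proj₂)
open import Data.Sum using (_⊎_; inj₁; inj₂; [_,_]′; map₂)
open import Data.Vec using (toList; zip; allFin) renaming (_∷_ to _∷ᵛ_)
open import Data.Vec.Membership.Propositional.Properties using (∈-lookup; ∈-toList⁺)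
open import Data.Vec.Properties using (lookup-zip; lookup-allFin)
open import Function using (id; Equivalence)
open import Relation.Binary.PropositionalEquality using (refl; sym; trans; cong; subst; subst₂; module ≡-Reasoning)

open Equivalence using (to; from)

Precedes : ∀ {a} {A : Set a} → A → A → List A → Set a
Precedes e f L = ∃[ p ] ∃[ q ] ∃[ r ] L ≡ p ++ e ∷ q ++ f ∷ r

module _ {a} {A : Set a} {e f : A} where

  precedes-++ : ∀ {xs ys : List A} → e ∈ xs → f ∈ ys → Precedes e f (xs ++ ys)
  precedes-++ e∈xs f∈ys with ∈-∃++ e∈xs | ∈-∃++ f∈ys
  ... | p , q , refl | u , w , refl = p , q ++ u , w , (begin
      (p ++ e ∷ q) ++ u ++ f ∷ w    ≡⟨ ++-assoc p (e ∷ q) _ ⟩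
      p ++ e ∷ q ++ u ++ f ∷ w      ≡⟨ cong (λ z → p ++ e ∷ z) (sym (++-assoc q u _)) ⟩
      p ++ e ∷ (q ++ u) ++ f ∷ w    ∎)
    where
    open ≡-Reasoning

  precedes-∷ : ∀ {x} {L : List A} → Precedes e f L → Precedes e f (x ∷ L)
  precedes-∷ {x} (p , q , r , eq) = x ∷ p , q , r , cong (x ∷_) eq

  precedes-map : ∀ {b} {B : Set b} (g : A → B) {L : List A} →
                 Precedes e f L → Precedes (g e) (g f) (map g L)
  precedes-map g (p , q , r , refl) =
    map g p , map g q , map g r ,
    trans (map-++ g p _) (cong (λ z → map g p ++ g e ∷ z) (map-++ g q _))

lookup-precedes : ∀ {a} {A : Set a} {m} (v : Vec A m) {i j : Fin m} → i <ᶠ j →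
                  Precedes (lookup v i) (lookup v j) (toList v)
lookup-precedes (x ∷ᵛ v) {zero}  {suc j} _         =
  precedes-++ {xs = [ x ]} (here refl) (∈-toList⁺ (∈-lookup j v))
lookup-precedes (x ∷ᵛ v) {suc i} {suc j} (s≤s i<j) = precedes-∷ (lookup-precedes v i<j)

module _ {n : ℕ} where

  Stack : Set
  Stack = List (Entry n)

  avoids21⇒top-minimal : ∀ (x : Entry n) st → T (avoids21 (x ∷ st)) →
                         ∀ {e} → e ∈ st → proj₂ x ≤ proj₂ e
  avoids21⇒top-minimal x (y ∷ st) ok e∈st with T-∧ {proj₂ x ≤ᵇ proj₂ y} .to ok
  ... | x≤ᵇy , ok′ with e∈st
  ...   | here refl  = ≤ᵇ⇒≤ _ _ x≤ᵇy
  ...   | there e∈st′ = ≤-trans (≤ᵇ⇒≤ _ _ x≤ᵇy) (avoids21⇒top-minimal y st ok′ e∈st′)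

  run-∷-pushElt : ∀ (x : Entry n) xs st out {st′ out′} → pushElt x st out ≡ (st′ , out′) →
                  run (x ∷ xs) st out ≡ run xs st′ out′
  run-∷-pushElt x xs st out eq with pushElt x st out | eq
  ... | _ | refl = refl

  pushElt-accept : ∀ (x : Entry n) st out → avoids21 (x ∷ st) ≡ true →
                   pushElt x st out ≡ (x ∷ st , out)
  pushElt-accept x st out ok with avoids21 (x ∷ st) | ok
  ... | true | _ = refl

  pushElt-reject : ∀ (x y : Entry n) st out → avoids21 (x ∷ y ∷ st) ≡ false →
                   pushElt x (y ∷ st) out ≡ pushElt x st (out ++ [ y ])
  pushElt-reject x y st out ko with avoids21 (x ∷ y ∷ st) | ko
  ... | false | _ = refl

  record PushOutcome (x : Entry n) (st out : Stack) : Set where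
    field
      kept popped    : Stack
      pushElt≡       : pushElt x st out ≡ (x ∷ kept , out ++ popped)
      kept-or-popped : ∀ {e} → e ∈ st → e ∈ kept ⊎ e ∈ popped
      smaller-popped : ∀ {e} → e ∈ st → proj₂ e < proj₂ x → e ∈ popped

    run-∷ : ∀ xs → run (x ∷ xs) st out ≡ run xs (x ∷ kept) (out ++ popped)
    run-∷ xs = run-∷-pushElt x xs st out pushElt≡

  push : ∀ (x : Entry n) st out → PushOutcome x st out
  push x st out with avoids21 (x ∷ st) in pushable
  ... | true = record
    { kept = st ; popped = []
    ; pushElt≡ = trans (pushElt-accept x st out pushable) (cong (x ∷ st ,_) (sym (++-identityʳ out)))
    ; kept-or-popped = inj₁
    ; smaller-popped = λ e∈st e<x →
        ⊥-elim (≤⇒≯ (avoids21⇒top-minimal x st (T-≡ .from pushable) e∈st) e<x)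
    }
  push x (y ∷ st) out | false = record
    { kept = kept ; popped = y ∷ popped
    ; pushElt≡ = trans (pushElt-reject x y st out pushable)
                       (trans pushElt≡ (cong (x ∷ kept ,_) (++-assoc out [ y ] popped)))
    ; kept-or-popped = λ { (here refl) → inj₂ (here refl)
                         ; (there e∈st) → map₂ there (kept-or-popped e∈st) }
    ; smaller-popped = λ { (here refl) _ → here refl
                         ; (there e∈st) e<x → there (smaller-popped e∈st e<x) }
    }
    where
    open PushOutcome (push x st (out ++ [ y ]))

  OutputExtension : (xs st out : Stack) → Set
  OutputExtension xs st out =
    ∃[ R ] run xs st out ≡ out ++ R × (∀ {e} → e ∈ xs ⊎ e ∈ st → e ∈ R)

  run-outputs-all : ∀ xs st out → OutputExtension xs st out
  run-outputs-all [] st out = st , refl , [ (λ ()) , id ]′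
  run-outputs-all (x ∷ xs) st out = extend (run-outputs-all xs (x ∷ kept) (out ++ popped))
    where
    open PushOutcome (push x st out)

    extend : OutputExtension xs (x ∷ kept) (out ++ popped) → OutputExtension (x ∷ xs) st out
    extend (R , run≡ , outputs) = popped ++ R ,
      trans (run-∷ xs) (trans run≡ (++-assoc out popped R)) ,
      λ { (inj₁ (here refl))  → ∈-++⁺ʳ popped (outputs (inj₂ (here refl)))
        ; (inj₁ (there e∈xs)) → ∈-++⁺ʳ popped (outputs (inj₁ e∈xs))
        ; (inj₂ e∈st) → [ (λ e∈kept → ∈-++⁺ʳ popped (outputs (inj₂ (there e∈kept)))) , ∈-++⁺ˡ ]′
                          (kept-or-popped e∈st) }

  output-precedes : ∀ {e f : Entry n} xs st out → e ∈ out → f ∈ xs ⊎ f ∈ st →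
                    Precedes e f (run xs st out)
  output-precedes xs st out e∈out f∈ with run-outputs-all xs st out
  ... | R , run≡ , outputs = subst (Precedes _ _) (sym run≡) (precedes-++ e∈out (outputs f∈))

  module _ {e f : Entry n} (e<f : proj₂ e < proj₂ f) where

    stacked-precedes : ∀ xs st out → e ∈ st → f ∈ xs → Precedes e f (run xs st out)
    stacked-precedes (x ∷ xs) st out e∈st (here refl) =
      subst (Precedes e f) (sym (run-∷ xs))
        (output-precedes xs (f ∷ kept) (out ++ popped)
          (∈-++⁺ʳ out (smaller-popped e∈st e<f)) (inj₂ (here refl)))
      where
      open PushOutcome (push f st out)
    stacked-precedes (x ∷ xs) st out e∈st (there f∈xs) =
      subst (Precedes e f) (sym (run-∷ xs)) ([ still-stacked , popped-before ]′ (kept-or-popped e∈st))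
      where
      open PushOutcome (push x st out)

      still-stacked : e ∈ kept → Precedes e f (run xs (x ∷ kept) (out ++ popped))
      still-stacked e∈kept = stacked-precedes xs (x ∷ kept) (out ++ popped) (there e∈kept) f∈xs

      popped-before : e ∈ popped → Precedes e f (run xs (x ∷ kept) (out ++ popped))
      popped-before e∈popped =
        output-precedes xs (x ∷ kept) (out ++ popped) (∈-++⁺ʳ out e∈popped) (inj₁ f∈xs)

    run-preserves-precedes : ∀ {xs} st out → Precedes e f xs → Precedes e f (run xs st out)
    run-preserves-precedes st out (p , q , r , refl) = go p st out
      where
      go : ∀ p st out → Precedes e f (run (p ++ e ∷ q ++ f ∷ r) st out)
      go [] st out = subst (Precedes e f) (sym (run-∷ (q ++ f ∷ r)))
        (stacked-precedes (q ++ f ∷ r) (e ∷ kept) (out ++ popped) (here refl) (∈-++⁺ʳ q (here refl)))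
        where
        open PushOutcome (push e st out)
      go (x ∷ p) st out =
        subst (Precedes e f) (sym (run-∷ (p ++ e ∷ q ++ f ∷ r))) (go p (x ∷ kept) (out ++ popped))
        where
        open PushOutcome (push x st out)

lookup-zip-allFin : ∀ {a} {A : Set a} {n} (v : Vec A n) (i : Fin n) →
                    lookup (zip (allFin n) v) i ≡ (i , lookup v i)
lookup-zip-allFin {n = n} v i =
  trans (lookup-zip i (allFin n) v) (cong (_, lookup v i) (lookup-allFin i))

lemma1 : ∀ {n} (π : Vec ℕ n) → IsCayley π → (i j : Fin n) → i <ᶠ j → lookup π i < lookup π j →
    ∃[ as ] ∃[ bs ] ∃[ cs ] s21Positions π ≡ as ++ i ∷ bs ++ j ∷ cs
lemma1 {n} π _ i j i<j πi<πj =
  precedes-map proj₁ (run-preserves-precedes πi<πj [] [] entries-precede)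
  where
  entries-precede : Precedes (i , lookup π i) (j , lookup π j) (toList (zip (allFin n) π))
  entries-precede = subst₂ (λ e f → Precedes e f _) (lookup-zip-allFin π i) (lookup-zip-allFin π j)
                      (lookup-precedes (zip (allFin n) π) i<j)
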